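{- Let $i,j$ be delay conditions and let $k=i\circ j$ be their serial connection, $k(u)=\{y\mid \exists x,\ x\in j(u)\text{ and }y\in i(x)\}$. Then: (a) $k$ is a delay condition; (b) if $i,j$ are deterministic, then $k$ is deterministic; (c) if $i,j$ are time invariant, then $k$ is time invariant; (d) if $i,j$ are symmetrical, then $k$ is symmetrical.
   Context: $\mathbf{B}=\{0,1\}$ with complement $\overline{\,\cdot\,}$ (extended pointwise to functions). A signal is a function $x:\mathbf{R}\rightarrow\mathbf{B}$ for which there exists an unbounded sequence $0\leq t_0<t_1<t_2<\dots$ of reals such that $x$ is constant on $(-\infty,t_0)$ and on each interval $[t_k,t_{k+1})$. $S$ is the set of signals, $P^*(S)$ the set of non-empty subsets of $S$, and $\tau^d(t)=t-d$. For $u,x\in S$, $(u,x)$ satisfies the stability condition (SC) if for every $a\in\mathbf{B}$: if $u(t)=a$ for all sufficiently large $t$, then $x(t)=a$ for all sufficiently large $t$; $Sol_{SC}(u)=\{x\in S\mid(u,x)\text{ satisfies SC}\}$. A delay condition (DC) is a function $i:S\rightarrow P^*(S)$ with $i(u)\subset Sol_{SC}(u)$ for all $u$. A DC $i$ is deterministic if each $i(u)$ has exactly one element. A DC $i$ is time invariant if for all $u\in S$, all $x$ and all $d\in\mathbf{R}$: if $u\circ\tau^d\in S$ and $x\in i(u)$ then $x\circ\tau^d\in S$ and $x\circ\tau^d\in i(u\circ\tau^d)$. A DC $i$ is (rising-falling) symmetrical if for all $u\in S$, $i(\overline{u})=\{\overline{x}\mid x\in i(u)\}$. -}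

module Defs where

open import Level using (Level; _⊔_) renaming (suc to lsuc; zero to lzero)
open import Data.Bool using (Bool; true; false; not)
open import Data.Nat using (ℕ; zero; suc)
open import Data.Product using (Σ; ∃; ∃-syntax; _×_; _,_)
open import Data.Sum using (_⊎_)
open import Relation.Binary.PropositionalEquality using (_≡_; _≢_)
open import Relation.Nullary using (¬_)
open import Algebra.Structures using (IsCommutativeRing)
open import Relation.Binary.Structures using (IsTotalOrder)
open import Function using (_∘_)

record RealField : Set₁ where
  infixl 6 _+_
  infixl 7 _*_
  infix  4 _≤_ _<_
  field
    Carrier : Set
    _+_ _*_ : Carrier → Carrier → Carrier
    -_      : Carrier → Carrier
    0# 1#   : Carrier
    _≤_     : Carrier → Carrier → Set
    isCommutativeRing : IsCommutativeRing _≡_ _+_ _*_ -_ 0# 1#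
    0≢1     : 0# ≢ 1#
    inverse : ∀ x → x ≢ 0# → ∃[ y ] (x * y ≡ 1#)
    isTotalOrder : IsTotalOrder _≡_ _≤_
    +-mono-≤ : ∀ {x y} z → x ≤ y → x + z ≤ y + z
    *-nonneg : ∀ {x y} → 0# ≤ x → 0# ≤ y → 0# ≤ x * y
    sup : (A : Carrier → Set) → (∃[ a ] A a) → (∃[ b ] (∀ a → A a → a ≤ b)) →
          ∃[ s ] ((∀ a → A a → a ≤ s) × (∀ b → (∀ a → A a → a ≤ b) → s ≤ b))

  _<_ : Carrier → Carrier → Set
  x < y = (x ≤ y) × (x ≢ y)

  _-_ : Carrier → Carrier → Carrier
  x - y = x + (- y)

module Signals (ℝ : RealField) where
  open RealField ℝ renaming (Carrier to R)

  Fn : Set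
  Fn = R → Bool

  IsSignal : Fn → Set
  IsSignal x = Σ (ℕ → R) λ t →
      (0# ≤ t 0)
    × (∀ k → t k < t (suc k))
    × (∀ M → ∃[ k ] (M < t k))
    × (∀ s s' → s < t 0 → s' < t 0 → x s ≡ x s')
    × (∀ k s s' → t k ≤ s → s < t (suc k) → t k ≤ s' → s' < t (suc k)
                → x s ≡ x s')

  τ : R → R → R
  τ d t = t - d

  EventuallyEq : Fn → Bool → Set
  EventuallyEq f a = ∃[ t₀ ] (∀ t → t₀ ≤ t → f t ≡ a)

  SC : Fn → Fn → Set
  SC u x = ∀ (a : Bool) → EventuallyEq u a → EventuallyEq x a

  -- A candidate delay condition: i u x means x ∈ i(u).
  -- (Subsets of S are predicates on functions; only arguments u ∈ S matter.)
  Cond : Set₁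
  Cond = Fn → Fn → Set

  IsDC : Cond → Set
  IsDC i = ∀ u → IsSignal u →
      (∃[ x ] i u x)
    × (∀ x → i u x → IsSignal x × SC u x)

  Deterministic : Cond → Set
  Deterministic i = ∀ u → IsSignal u →
    ∃[ x ] (i u x × (∀ y → i u y → y ≡ x))

  TimeInvariant : Cond → Set
  TimeInvariant i = ∀ u → IsSignal u → ∀ x (d : R) →
    IsSignal (u ∘ τ d) → i u x →
    IsSignal (x ∘ τ d) × i (u ∘ τ d) (x ∘ τ d)

  -- i(ū) = { x̄ | x ∈ i(u) }  (set equality as mutual inclusion)
  Symmetrical : Cond → Set
  Symmetrical i = ∀ u → IsSignal u → ∀ y →
      (i (not ∘ u) y → ∃[ x ] (i u x × y ≡ not ∘ x))
    × ((∃[ x ] (i u x × y ≡ not ∘ x)) → i (not ∘ u) y)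

  serial : Cond → Cond → Cond
  serial i j u y = ∃[ x ] (j u x × i x y)

{-# OPTIONS --safe #-}
module Submission where

open import Defs
open import Data.Product using (_×_; _,_; proj₁; proj₂; ∃-syntax)
open import Data.Bool using (not)
open import Function using (_∘_)
open import Relation.Binary.PropositionalEquality using (_≡_; refl; subst)

module _ (ℝ : RealField) where
  open Signals ℝ

  SC-trans : ∀ {u x y} → SC u x → SC x y → SC u y
  SC-trans ux xy a = xy a ∘ ux a

  -- The hypotheses on i only speak about signal inputs; IsDC j is what makes
  -- the intermediate x ∈ j(u) a signal.
  module _ {j : Cond} (dcj : IsDC j) where

    output-isSignal : ∀ {u x} → IsSignal u → j u x → IsSignal x
    output-isSignal su jx = proj₁ (proj₂ (dcj _ su) _ jx)

    serial-isDC : ∀ {i} → IsDC i → IsDC (serial i j)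
    serial-isDC {i} dci u su = nonempty , outputs
      where
      nonempty : ∃[ y ] serial i j u y
      nonempty =
        let (x , jx) = proj₁ (dcj u su)
            (y , iy) = proj₁ (dci x (output-isSignal su jx))
        in y , x , jx , iy

      outputs : ∀ y → serial i j u y → IsSignal y × SC u y
      outputs y (x , jx , iy) =
        let (sx , scx) = proj₂ (dcj u su) x jx
            (sy , scy) = proj₂ (dci x sx) y iy
        in sy , SC-trans scx scy

    serial-deterministic : ∀ {i} → Deterministic i → Deterministic j →
                           Deterministic (serial i j)
    serial-deterministic {i} di dj u su =
      let (x , jx , x-unique) = dj u su
          (y , iy , y-unique) = di x (output-isSignal su jx)
      in y , (x , jx , iy) ,
         λ { y′ (x′ , jx′ , iy′) → y-unique y′ (subst (λ z → i z y′) (x-unique x′ jx′) iy′) }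

    serial-timeInvariant : ∀ {i} → TimeInvariant i → TimeInvariant j →
                           TimeInvariant (serial i j)
    serial-timeInvariant ti tj u su y d sud (x , jx , iy) =
      let (sxd , jxd) = tj u su x d sud jx
          (syd , iyd) = ti x (output-isSignal su jx) y d sxd iy
      in syd , x ∘ τ d , jxd , iyd

    serial-symmetrical : ∀ {i} → Symmetrical i → Symmetrical j →
                         Symmetrical (serial i j)
    serial-symmetrical {i} si sj u su y = from-complement , to-complement
      where
      from-complement : serial i j (not ∘ u) y →
                        ∃[ y′ ] (serial i j u y′ × y ≡ not ∘ y′)
      from-complement (x , jx , iy) with proj₁ (sj u su x) jx
      ... | x′ , jx′ , refl =
        let (y′ , iy′ , y≡not-y′) = proj₁ (si x′ (output-isSignal su jx′) y) iy
        in y′ , (x′ , jx′ , iy′) , y≡not-y′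

      to-complement : ∃[ y′ ] (serial i j u y′ × y ≡ not ∘ y′) →
                      serial i j (not ∘ u) y
      to-complement (y′ , (x′ , jx′ , iy′) , y≡not-y′) =
        not ∘ x′ , proj₂ (sj u su (not ∘ x′)) (x′ , jx′ , refl)
                 , proj₂ (si x′ (output-isSignal su jx′) y) (y′ , iy′ , y≡not-y′)

theorem10p2 : (ℝ : RealField) → let open Signals ℝ in
    (i j : Cond) → IsDC i → IsDC j →
      IsDC (serial i j)
    × (Deterministic i → Deterministic j → Deterministic (serial i j))
    × (TimeInvariant i → TimeInvariant j → TimeInvariant (serial i j))
    × (Symmetrical i → Symmetrical j → Symmetrical (serial i j))
theorem10p2 ℝ i j dci dcj =
    serial-isDC ℝ dcj dci
  , serial-deterministic ℝ dcj
  , serial-timeInvariant ℝ dcj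
  , serial-symmetrical ℝ dcj
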